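{- Let $k\ge 1$ and let $T_1,\ldots,T_k$ be rooted planar trees, and $T = T_1\otimes T_2\otimes\cdots\otimes T_k$. Then for any path $p = p_1\otimes\cdots\otimes p_k\in \mathrm{Path}(T)$ with $p_j\in\mathrm{Path}(T_j)$, $$\mathrm{rank}_T(p) = \sum_{j=1}^k \mathrm{rank}_{T_j}(p_j)\prod_{l=j+1}^k L(T_l),$$ where an empty product equals $1$.
   Context: For a rooted planar tree $T$, $L(T)$ is its number of leaves and $\mathrm{Path}(T)$ is the set of paths from the root to a leaf; for $p\in\mathrm{Path}(T)$, $\mathrm{rank}_T(p)$ is the number of leaves of $T$ lying to the left of $p$ (in the planar order). For rooted planar trees $T_1,T_2$, $T_1\otimes T_2$ is the rooted planar tree obtained from $T_1$ by replacing each leaf of $T_1$ by a copy of $T_2$ (root of the copy identified with that leaf); for $k\ge3$, $T_1\otimes\cdots\otimes T_k=(T_1\otimes\cdots\otimes T_{k-1})\otimes T_k$. For $p_1\in\mathrm{Path}(T_1)$ ending at leaf $l$ and $p_2\in\mathrm{Path}(T_2)$, $p_1\otimes p_2\in\mathrm{Path}(T_1\otimes T_2)$ is the path following $p_1$ to $l$ and then following $p_2$ in the copy of $T_2$ attached at $l$; iterated products of paths are defined inductively in the same way. -}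

module Defs where

open import Data.Nat using (ℕ; zero; suc; _+_; _*_)
open import Data.List using (List; []; _∷_)
open import Data.Fin using (Fin; zero; suc; inject₁; fromℕ; _<?_)
open import Relation.Nullary using (does)
open import Data.Bool using (if_then_else_)

data Tree : Set where
  node : List Tree → Tree

mutual
  L : Tree → ℕ
  L (node []) = 1
  L (node (t ∷ ts)) = LL (t ∷ ts)

  LL : List Tree → ℕ
  LL [] = 0
  LL (t ∷ ts) = L t + LL ts

mutual
  data Path : Tree → Set where
    here  : Path (node [])
    there : ∀ {t ts} → PathL (t ∷ ts) → Path (node (t ∷ ts))

  -- a choice of child (by position) together with a path in it
  data PathL : List Tree → Set where
    hd : ∀ {t ts} → Path t → PathL (t ∷ ts)
    tl : ∀ {t ts} → PathL ts → PathL (t ∷ ts)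

-- rank: number of leaves strictly to the left of the path
mutual
  rank : ∀ {T} → Path T → ℕ
  rank here = 0
  rank (there p) = rankL p

  rankL : ∀ {ts} → PathL ts → ℕ
  rankL (hd p) = rank p
  rankL (tl {t} p) = L t + rankL p

mutual
  _⊗_ : Tree → Tree → Tree
  node [] ⊗ T₂ = T₂
  node (t ∷ ts) ⊗ T₂ = node (graftL (t ∷ ts) T₂)

  graftL : List Tree → Tree → List Tree
  graftL [] T₂ = []
  graftL (t ∷ ts) T₂ = (t ⊗ T₂) ∷ graftL ts T₂

mutual
  _⊗ₚ_ : ∀ {T₁ T₂} → Path T₁ → Path T₂ → Path (T₁ ⊗ T₂)
  here ⊗ₚ q = q
  there p ⊗ₚ q = there (p ⊗ₚL q)

  _⊗ₚL_ : ∀ {ts T₂} → PathL ts → Path T₂ → PathL (graftL ts T₂)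
  hd p ⊗ₚL q = hd (p ⊗ₚ q)
  tl p ⊗ₚL q = tl (p ⊗ₚL q)

-- iterated product T₀ ⊗ ⋯ ⊗ Tₙ (k = n+1 factors, 0-indexed), left-associated
⨂ : (n : ℕ) → (Fin (suc n) → Tree) → Tree
⨂ zero T = T zero
⨂ (suc n) T = ⨂ n (λ i → T (inject₁ i)) ⊗ T (fromℕ (suc n))

⨂ₚ : (n : ℕ) (T : Fin (suc n) → Tree) → ((j : Fin (suc n)) → Path (T j)) → Path (⨂ n T)
⨂ₚ zero T p = p zero
⨂ₚ (suc n) T p = ⨂ₚ n (λ i → T (inject₁ i)) (λ i → p (inject₁ i)) ⊗ₚ p (fromℕ (suc n))

∑ : (n : ℕ) → (Fin n → ℕ) → ℕ
∑ zero f = 0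
∑ (suc n) f = f zero + ∑ n (λ i → f (suc i))

∏ : (n : ℕ) → (Fin n → ℕ) → ℕ
∏ zero f = 1
∏ (suc n) f = f zero * ∏ n (λ i → f (suc i))

-- Grafting multiplies leaf counts, and a product path p ⊗ q has exactly
-- rank p · L T₂ + rank q leaves to its left: each leaf left of p contributes a
-- whole copy of T₂, and within its own copy q has rank q leaves to its left.
-- Iterating this over T₁ ⊗ ⋯ ⊗ Tₖ is Horner's scheme for the mixed-radix
-- number with digits rank pⱼ and radices L Tⱼ, which is the stated sum.
module Submission where

open import Defs
open import Data.Nat as ℕ using (ℕ; zero; suc; _+_; _*_)
open import Data.Nat.Properties
  using (+-assoc; +-identityʳ; *-identityʳ; *-assoc; *-comm; *-distribʳ-+; ≤⇒≯)
  renaming (_<?_ to _<ℕ?_)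
open import Data.Fin as Fin using (Fin; _<_; _<?_; inject₁; fromℕ; toℕ)
open import Data.Fin.Properties using (toℕ-inject₁; toℕ-fromℕ; inject₁ℕ<; ≤fromℕ)
open import Data.List using ([]; _∷_)
open import Data.Bool using (if_then_else_)
open import Function using (_∘_)
open import Relation.Nullary using (does; ¬_)
open import Relation.Nullary.Decidable using (dec-true; dec-false)
open import Relation.Binary.PropositionalEquality
  using (_≡_; refl; sym; trans; cong; cong₂; subst; module ≡-Reasoning)

mutual
  L-⊗ : ∀ T₁ T₂ → L (T₁ ⊗ T₂) ≡ L T₁ * L T₂
  L-⊗ (node []) T₂ = sym (+-identityʳ (L T₂))
  L-⊗ (node (t ∷ ts)) T₂ = LL-graftL (t ∷ ts) T₂

  LL-graftL : ∀ ts T₂ → LL (graftL ts T₂) ≡ LL ts * L T₂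
  LL-graftL [] T₂ = refl
  LL-graftL (t ∷ ts) T₂ =
    trans (cong₂ _+_ (L-⊗ t T₂) (LL-graftL ts T₂)) (sym (*-distribʳ-+ (L T₂) (L t) (LL ts)))

mutual
  rank-⊗ₚ : ∀ {T₁ T₂} (p : Path T₁) (q : Path T₂) → rank (p ⊗ₚ q) ≡ rank p * L T₂ + rank q
  rank-⊗ₚ here q = refl
  rank-⊗ₚ (there p) q = rankL-⊗ₚL p q

  rankL-⊗ₚL : ∀ {ts T₂} (p : PathL ts) (q : Path T₂) → rankL (p ⊗ₚL q) ≡ rankL p * L T₂ + rank q
  rankL-⊗ₚL (hd p) q = rank-⊗ₚ p q
  rankL-⊗ₚL {t ∷ _} {T₂} (tl p) q = begin
      L (t ⊗ T₂) + rankL (p ⊗ₚL q)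
    ≡⟨ cong₂ _+_ (L-⊗ t T₂) (rankL-⊗ₚL p q) ⟩
      L t * L T₂ + (rankL p * L T₂ + rank q)
    ≡⟨ sym (+-assoc (L t * L T₂) _ _) ⟩
      L t * L T₂ + rankL p * L T₂ + rank q
    ≡⟨ cong (_+ rank q) (sym (*-distribʳ-+ (L T₂) (L t) (rankL p))) ⟩
      (L t + rankL p) * L T₂ + rank q
    ∎
    where open ≡-Reasoning

∑-cong : ∀ m {f g : Fin m → ℕ} → (∀ i → f i ≡ g i) → ∑ m f ≡ ∑ m g
∑-cong zero    f≗g = refl
∑-cong (suc m) f≗g = cong₂ _+_ (f≗g Fin.zero) (∑-cong m (f≗g ∘ Fin.suc))

∏-cong : ∀ m {f g : Fin m → ℕ} → (∀ i → f i ≡ g i) → ∏ m f ≡ ∏ m g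
∏-cong zero    f≗g = refl
∏-cong (suc m) f≗g = cong₂ _*_ (f≗g Fin.zero) (∏-cong m (f≗g ∘ Fin.suc))

∑-init-last : ∀ m (f : Fin (suc m) → ℕ) → ∑ (suc m) f ≡ ∑ m (f ∘ inject₁) + f (fromℕ m)
∑-init-last zero    f = +-identityʳ (f Fin.zero)
∑-init-last (suc m) f =
  trans (cong (f Fin.zero +_) (∑-init-last m (f ∘ Fin.suc))) (sym (+-assoc (f Fin.zero) _ _))

∏-init-last : ∀ m (f : Fin (suc m) → ℕ) → ∏ (suc m) f ≡ ∏ m (f ∘ inject₁) * f (fromℕ m)
∏-init-last zero    f = *-comm (f Fin.zero) 1
∏-init-last (suc m) f =
  trans (cong (f Fin.zero *_) (∏-init-last m (f ∘ Fin.suc))) (sym (*-assoc (f Fin.zero) _ _))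

∑-*ʳ : ∀ m (f : Fin m → ℕ) c → ∑ m (λ i → f i * c) ≡ ∑ m f * c
∑-*ʳ zero    f c = refl
∑-*ʳ (suc m) f c =
  trans (cong (f Fin.zero * c +_) (∑-*ʳ m (f ∘ Fin.suc) c)) (sym (*-distribʳ-+ c (f Fin.zero) _))

∏-ones : ∀ m (f : Fin m → ℕ) → (∀ i → f i ≡ 1) → ∏ m f ≡ 1
∏-ones zero    f f≗1 = refl
∏-ones (suc m) f f≗1 = cong₂ _*_ (f≗1 Fin.zero) (∏-ones m (f ∘ Fin.suc) (f≗1 ∘ Fin.suc))

-- Fin's _<?_ compares the underlying naturals.
inject₁<?inject₁ : ∀ {m n} (i : Fin m) (j : Fin n) → does (inject₁ i <? inject₁ j) ≡ does (i <? j)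
inject₁<?inject₁ i j = cong₂ (λ a b → does (a <ℕ? b)) (toℕ-inject₁ i) (toℕ-inject₁ j)

inject₁<fromℕ : ∀ {m} (i : Fin m) → inject₁ i < fromℕ m
inject₁<fromℕ {m} i = subst (toℕ (inject₁ i) ℕ.<_) (sym (toℕ-fromℕ m)) (inject₁ℕ< i)

fromℕ≮ : ∀ {m} (j : Fin (suc m)) → ¬ fromℕ m < j
fromℕ≮ j = ≤⇒≯ (≤fromℕ j)

∏-after : (m : ℕ) → (Fin m → ℕ) → Fin m → ℕ
∏-after m w j = ∏ m (λ l → if does (j <? l) then w l else 1)

∏-after-inject₁ : ∀ m (w : Fin (suc m) → ℕ) (i : Fin m)
  → ∏-after (suc m) w (inject₁ i) ≡ ∏-after m (w ∘ inject₁) i * w (fromℕ m)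
∏-after-inject₁ m w i =
  trans (∏-init-last m (λ l → if does (inject₁ i <? l) then w l else 1)) (cong₂ _*_ earlier last)
  where
  earlier : ∏ m (λ l → if does (inject₁ i <? inject₁ l) then w (inject₁ l) else 1)
          ≡ ∏-after m (w ∘ inject₁) i
  earlier = ∏-cong m (λ l → cong (if_then w (inject₁ l) else 1) (inject₁<?inject₁ i l))
  last : (if does (inject₁ i <? fromℕ m) then w (fromℕ m) else 1) ≡ w (fromℕ m)
  last = cong (if_then w (fromℕ m) else 1) (dec-true (inject₁ i <? fromℕ m) (inject₁<fromℕ i))

∏-after-fromℕ : ∀ m (w : Fin (suc m) → ℕ) → ∏-after (suc m) w (fromℕ m) ≡ 1
∏-after-fromℕ m w = ∏-ones (suc m) _
  (λ l → cong (if_then w l else 1) (dec-false (fromℕ m <? l) (fromℕ≮ l)))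

-- The value of the digits r in the mixed radix system with radices w
-- (most significant digit first).
mixedRadix : (m : ℕ) → (Fin m → ℕ) → (Fin m → ℕ) → ℕ
mixedRadix m w r = ∑ m (λ j → r j * ∏-after m w j)

mixedRadix-horner : ∀ m (w r : Fin (suc m) → ℕ)
  → mixedRadix (suc m) w r ≡ mixedRadix m (w ∘ inject₁) (r ∘ inject₁) * w (fromℕ m) + r (fromℕ m)
mixedRadix-horner m w r = begin
    mixedRadix (suc m) w r
  ≡⟨ ∑-init-last m (λ j → r j * ∏-after (suc m) w j) ⟩
    ∑ m (λ i → r (inject₁ i) * ∏-after (suc m) w (inject₁ i)) + r (fromℕ m) * ∏-after (suc m) w (fromℕ m)
  ≡⟨ cong₂ _+_ (∑-cong m initial) final ⟩
    ∑ m (λ i → r (inject₁ i) * ∏-after m (w ∘ inject₁) i * w (fromℕ m)) + r (fromℕ m)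
  ≡⟨ cong (_+ r (fromℕ m)) (∑-*ʳ m (λ i → r (inject₁ i) * ∏-after m (w ∘ inject₁) i) (w (fromℕ m))) ⟩
    mixedRadix m (w ∘ inject₁) (r ∘ inject₁) * w (fromℕ m) + r (fromℕ m)
  ∎
  where
  open ≡-Reasoning
  initial : ∀ i → r (inject₁ i) * ∏-after (suc m) w (inject₁ i)
                ≡ r (inject₁ i) * ∏-after m (w ∘ inject₁) i * w (fromℕ m)
  initial i = trans (cong (r (inject₁ i) *_) (∏-after-inject₁ m w i)) (sym (*-assoc (r (inject₁ i)) _ _))
  final : r (fromℕ m) * ∏-after (suc m) w (fromℕ m) ≡ r (fromℕ m)
  final = trans (cong (r (fromℕ m) *_) (∏-after-fromℕ m w)) (*-identityʳ (r (fromℕ m)))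

lemma4 : (n : ℕ) (T : Fin (suc n) → Tree) (p : (j : Fin (suc n)) → Path (T j))
    → rank (⨂ₚ n T p)
      ≡ ∑ (suc n) (λ j → rank (p j) * ∏ (suc n) (λ l → if does (j <? l) then L (T l) else 1))
-- A single factor is one Horner step from the empty number 0.
lemma4 zero T p = sym (mixedRadix-horner zero (L ∘ T) (λ j → rank (p j)))
lemma4 (suc n) T p = begin
    rank (⨂ₚ n (T ∘ inject₁) (p ∘ inject₁) ⊗ₚ p last)
  ≡⟨ rank-⊗ₚ (⨂ₚ n (T ∘ inject₁) (p ∘ inject₁)) (p last) ⟩
    rank (⨂ₚ n (T ∘ inject₁) (p ∘ inject₁)) * L (T last) + rank (p last)
  ≡⟨ cong (λ x → x * L (T last) + rank (p last)) (lemma4 n (T ∘ inject₁) (p ∘ inject₁)) ⟩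
    mixedRadix (suc n) (L ∘ T ∘ inject₁) (λ i → rank (p (inject₁ i))) * L (T last) + rank (p last)
  ≡⟨ sym (mixedRadix-horner (suc n) (L ∘ T) (λ j → rank (p j))) ⟩
    mixedRadix (suc (suc n)) (L ∘ T) (λ j → rank (p j))
  ∎
  where
  open ≡-Reasoning
  last : Fin (suc (suc n))
  last = fromℕ (suc n)
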